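{- Let $G=(V^+,V^-;E)$ be a bipartite graph with $|V^+|>|V^-|$ and weights $w\colon E\to\mathbb{R}$. Let $G'=(V^+,V'^-;E')$ be the balanced bipartite graph obtained by adding $|V^+|-|V^-|$ new "dummy" vertices to $V^-$, each joined to every vertex of $V^+$ by a new edge, and let $w'\colon E'\to\mathbb{R}$ extend $w$ by giving weight $0$ to every edge incident to a dummy vertex. Suppose $\mu'$ is a minimum-weight perfect matching in $(G',w')$. Let $s\in V^+\cup V^-$ be a non-dummy vertex and let $\tilde w'\colon E'\to\mathbb{R}$ be weights with $\tilde w'(e)=w'(e)$ for every edge $e\in E'$ not incident to $s$ and $\tilde w'(e)=0$ for every edge $e$ incident to a dummy vertex. If the directed graph $(G'_{\mu'},\tilde w'_{\mu'})$ contains a negative cycle, then it has a minimum-weight directed cycle that passes through at most one dummy vertex.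
   Context: For a matching $\mu$ in a bipartite graph $H=(A,B;F)$ with weights $c$, the auxiliary graph $H_\mu$ is the directed graph on $A\cup B$ whose arcs are the edges of $F\setminus\mu$ directed from $A$ to $B$ with weight $c(e)$, together with the reverses of the edges of $\mu$ (directed from $B$ to $A$) with weight $-c(e)$; these weights are denoted $c_\mu$. The weight of a directed cycle is the sum of its arc weights; a negative cycle has negative weight; a matching is perfect if it covers every vertex.
   Formalization: The weights $w$ and $\tilde w'$ are rational rather than real, so $w'$ is rational as well. -}

module Defs where

open import Data.Nat as ℕ using (ℕ; zero; suc)
open import Data.Fin using (Fin; zero; suc)
open import Data.Bool using (Bool; true; false; if_then_else_)
open import Data.Sum using (_⊎_; inj₁; inj₂)
open import Data.Product using (Σ; _×_; _,_; proj₁; proj₂)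
open import Data.List using (List; []; _∷_; map)
open import Data.Rational using (ℚ; 0ℚ; _+_; -_)
open import Data.Empty using (⊥)
open import Data.Unit using (⊤)
open import Relation.Binary.PropositionalEquality using (_≡_; _≢_)
open import Data.List.Relation.Unary.All using (All)
open import Data.List.Relation.Unary.Unique.Propositional using (Unique)

sumFin : (n : ℕ) → (Fin n → ℚ) → ℚ
sumFin zero    f = 0ℚ
sumFin (suc n) f = f zero + sumFin n (λ i → f (suc i))

sumList : List ℚ → ℚ
sumList []       = 0ℚ
sumList (x ∷ xs) = x + sumList xs

-- Bipartite graphs H = (A, B; F): simple, edge set given as a
-- decidable relation F : A → B → Bool.  A matching / edge subset is
-- likewise a relation M : A → B → Bool.

ExactlyOneB : {A B : Set} → (A → B → Bool) → A → Set
ExactlyOneB {A} {B} M a = Σ B λ b → (M a b ≡ true) × (∀ b' → M a b' ≡ true → b' ≡ b)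

ExactlyOneA : {A B : Set} → (A → B → Bool) → B → Set
ExactlyOneA {A} {B} M b = Σ A λ a → (M a b ≡ true) × (∀ a' → M a' b ≡ true → a' ≡ a)

IsPerfectMatching : {A B : Set} → (A → B → Bool) → (A → B → Bool) → Set
IsPerfectMatching {A} {B} F M =
  (∀ a b → M a b ≡ true → F a b ≡ true) ×
  (∀ a → ExactlyOneB M a) ×
  (∀ b → ExactlyOneA M b)

Arc : {A B : Set} → (A → B → Bool) → (A → B → Bool) → A ⊎ B → A ⊎ B → Set
Arc F M (inj₁ a) (inj₂ b) = (F a b ≡ true) × (M a b ≡ false)
Arc F M (inj₂ b) (inj₁ a) = M a b ≡ true
Arc F M (inj₁ _) (inj₁ _) = ⊥
Arc F M (inj₂ _) (inj₂ _) = ⊥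

-- c_μ on arcs (the value on non-arcs is irrelevant)
arcWeight : {A B : Set} → (A → B → Bool) → (A → B → ℚ) → A ⊎ B → A ⊎ B → ℚ
arcWeight M c (inj₁ a) (inj₂ b) = c a b
arcWeight M c (inj₂ b) (inj₁ a) = - c a b
arcWeight M c (inj₁ _) (inj₁ _) = 0ℚ
arcWeight M c (inj₂ _) (inj₂ _) = 0ℚ

cyclePairs : {V : Set} → List V → List (V × V)
cyclePairs {V} []       = []
cyclePairs {V} (v ∷ vs) = go v vs
  where
  go : V → List V → List (V × V)
  go x []      = (x , v) ∷ []
  go x (y ∷ r) = (x , y) ∷ go y r

record DirCycle {A B : Set} (F M : A → B → Bool) : Set where
  field
    verts    : List (A ⊎ B)
    nonempty : verts ≢ []
    distinct : Unique verts
    arcs     : All (λ p → Arc F M (proj₁ p) (proj₂ p)) (cyclePairs verts)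
open DirCycle public

cycleWeight : {A B : Set} {F M : A → B → Bool} → (A → B → ℚ) → DirCycle F M → ℚ
cycleWeight {M = M} c C =
  sumList (map (λ p → arcWeight M c (proj₁ p) (proj₂ p)) (cyclePairs (verts C)))

-- The balanced graph G' = (V⁺, V'⁻; E') from G = (V⁺, V⁻; E),
-- V⁺ = Fin m, V⁻ = Fin n, V'⁻ = Fin n ⊎ Fin k (inj₂ = the k dummies).

extEdges : {m n k : ℕ} → (Fin m → Fin n → Bool) → Fin m → Fin n ⊎ Fin k → Bool
extEdges E a (inj₁ j) = E a j
extEdges E a (inj₂ _) = true

extWeights : {m n k : ℕ} → (Fin m → Fin n → ℚ) → Fin m → Fin n ⊎ Fin k → ℚ
extWeights w a (inj₁ j) = w a j
extWeights w a (inj₂ _) = 0ℚ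

matchWeight : {m n k : ℕ} → (Fin m → Fin n ⊎ Fin k → Bool) → (Fin m → Fin n ⊎ Fin k → ℚ) → ℚ
matchWeight {m} {n} {k} M c =
  sumFin m λ a →
    sumFin n (λ j → if M a (inj₁ j) then c a (inj₁ j) else 0ℚ) +
    sumFin k (λ d → if M a (inj₂ d) then c a (inj₂ d) else 0ℚ)

Incident : {m n k : ℕ} → Fin m ⊎ Fin n → Fin m → Fin n ⊎ Fin k → Set
Incident (inj₁ a') a b = a' ≡ a
Incident (inj₂ j)  a b = b ≡ inj₁ j

dummyCount : {m n k : ℕ} → List (Fin m ⊎ (Fin n ⊎ Fin k)) → ℕ
dummyCount []                    = 0
dummyCount (inj₂ (inj₂ _) ∷ vs)  = suc (dummyCount vs)
dummyCount (inj₂ (inj₁ _) ∷ vs)  = dummyCount vs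
dummyCount (inj₁ _ ∷ vs)         = dummyCount vs

{-# OPTIONS --safe #-}
module Submission where

-- Because μ′ has minimum weight, every directed cycle C of G′_μ′ has nonnegative w′-weight:
-- μ′ Δ C is again a perfect matching, of weight w′(μ′) + w′_μ′(C).  A cycle avoiding s has the
-- same weight under w̃′ as under w′, so it is nonnegative for w̃′ as well.  All arcs at dummy
-- vertices have w̃′-weight 0, so a cycle through two dummies d₁, d₂ splits into walks d₁ → d₂
-- and d₂ → d₁ whose weights add up to its own; redirecting the last arc of each walk to its
-- first vertex closes it into a cycle of the same weight, unless the walk is a single matching
-- arc, of weight 0.  At least one of the two cycles avoids s and so has nonnegative weight;
-- the other one is then at most as heavy as the original cycle, and has fewer dummies.
-- There are finitely many cycles, so a minimum-weight cycle exists, and it is negative;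
-- splitting it repeatedly yields a minimum-weight cycle with at most one dummy.

open import Algebra.Bundles using (CommutativeMonoid)
open import Data.Bool using (Bool; true; false; if_then_else_)
import Data.Bool.Properties as Bool
open import Data.Empty using (⊥-elim)
open import Data.Fin using (Fin; zero; suc)
open import Data.Fin.Properties using () renaming (_≟_ to _≟Fin_)
open import Data.List using (List; []; _∷_; _++_; _∷ʳ_; map; tabulate; allFin; length; cartesianProductWith; mapMaybe)
open import Data.List.Properties using (map-++; map-∘; map-tabulate; ++-assoc; ++-identityʳ; length-removeAt′)
open import Data.List.Membership.Propositional using (_∈_; _∉_; _─_)
open import Data.List.Membership.Propositional.Properties
  using (∈-map⁺; ∈-map⁻; ∈-++⁺ˡ; ∈-++⁺ʳ; ∈-allFin; ∈-cartesianProductWith⁺)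
open import Data.List.Relation.Binary.Permutation.Propositional as ↭ using (_↭_)
import Data.List.Relation.Binary.Permutation.Propositional.Properties as ↭
import Data.List.Relation.Binary.Permutation.Setoid.Properties as PermutationSetoid
open import Data.List.Relation.Unary.All as All using (All; []; _∷_)
import Data.List.Relation.Unary.All.Properties as All
open import Data.List.Relation.Unary.Any using (here; there; index)
import Data.List.Relation.Unary.Any as Any
import Data.List.Relation.Unary.Any.Properties as Any
open import Data.List.Relation.Unary.Unique.Propositional using (Unique; []; _∷_)
import Data.List.Relation.Unary.Unique.Propositional.Properties as Unique
open import Data.List.Relation.Unary.Unique.DecPropositional using (unique?)
open import Data.Maybe using (Maybe; just; nothing)
import Data.Maybe.Relation.Unary.Any as MaybeAny
open import Data.Nat as ℕ using (ℕ; zero; suc; z≤n; s≤s; _∸_)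
import Data.Nat.Properties as ℕ
open import Data.Product using (Σ; Σ-syntax; _×_; _,_; proj₁; proj₂)
open import Data.Product.Properties using () renaming (≡-dec to ×-≡-dec)
open import Data.Rational using (ℚ; 0ℚ; _+_; -_; _≤_; _<_)
open import Data.Rational.Properties
  using ( +-assoc; +-identityˡ; +-identityʳ; +-inverseˡ; +-inverseʳ; +-monoʳ-≤; +-monoˡ-≤
        ; ≤-reflexive; ≤-trans; ≤-<-trans; <-irrefl; ≤-decTotalOrder; +-0-commutativeMonoid)
open import Data.Sum using (_⊎_; inj₁; inj₂)
open import Data.Sum.Properties using (inj₁-injective; inj₂-injective) renaming (≡-dec to ⊎-≡-dec)
open import Function using (_∘_; id)
open import Relation.Binary.Bundles using (DecTotalOrder)
open import Relation.Binary.Definitions using (DecidableEquality)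
open import Relation.Binary.PropositionalEquality
  using (_≡_; _≢_; refl; sym; trans; cong; cong₂; subst; subst₂; ≢-sym; setoid; module ≡-Reasoning)
open import Relation.Nullary using (¬_; Dec; yes; no; does; contradiction)
open import Relation.Nullary.Decidable using (dec-true; dec-false; _×-dec_)

open import Defs

open import Algebra.Properties.CommutativeSemigroup
  (CommutativeMonoid.commutativeSemigroup +-0-commutativeMonoid) using (interchange; x∙yz≈y∙xz)
open import Data.List.Extrema (DecTotalOrder.totalOrder ≤-decTotalOrder) using (argmin; f[argmin]≤f[xs])

x≤x+y⇒0≤y : (x y : ℚ) → x ≤ x + y → 0ℚ ≤ y
x≤x+y⇒0≤y x y x≤x+y = subst₂ _≤_ (+-inverseˡ x) -x+[x+y]≡y (+-monoʳ-≤ (- x) x≤x+y)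
  where
  -x+[x+y]≡y : - x + (x + y) ≡ y
  -x+[x+y]≡y = trans (sym (+-assoc (- x) x y)) (trans (cong (_+ y) (+-inverseˡ x)) (+-identityˡ y))

0≤x⇒y≤x+y : {x : ℚ} (y : ℚ) → 0ℚ ≤ x → y ≤ x + y
0≤x⇒y≤x+y {x} y 0≤x = subst (_≤ x + y) (+-identityˡ y) (+-monoˡ-≤ y 0≤x)

0≤y⇒x≤x+y : (x : ℚ) {y : ℚ} → 0ℚ ≤ y → x ≤ x + y
0≤y⇒x≤x+y x {y} 0≤y = subst (_≤ x + y) (+-identityʳ x) (+-monoʳ-≤ x 0≤y)

sumList-++ : (xs ys : List ℚ) → sumList (xs ++ ys) ≡ sumList xs + sumList ys
sumList-++ []       ys = sym (+-identityˡ _)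
sumList-++ (x ∷ xs) ys = trans (cong (x +_) (sumList-++ xs ys)) (sym (+-assoc x _ _))

sumList-↭ : {xs ys : List ℚ} → xs ↭ ys → sumList xs ≡ sumList ys
sumList-↭ ↭.refl         = refl
sumList-↭ (↭.prep x p)   = cong (x +_) (sumList-↭ p)
sumList-↭ (↭.swap x y p) = trans (cong (λ s → x + (y + s)) (sumList-↭ p)) (x∙yz≈y∙xz x y _)
sumList-↭ (↭.trans p q)  = trans (sumList-↭ p) (sumList-↭ q)

module _ {W : Set} where

  sumList-cong : (f g : W → ℚ) (L : List W) → (∀ {x} → x ∈ L → f x ≡ g x) →
                 sumList (map f L) ≡ sumList (map g L)
  sumList-cong f g []      f≗g = refl
  sumList-cong f g (x ∷ L) f≗g = cong₂ _+_ (f≗g (here refl)) (sumList-cong f g L (f≗g ∘ there))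

  sumList-distrib : (f g : W → ℚ) (L : List W) →
                    sumList (map (λ x → f x + g x) L) ≡ sumList (map f L) + sumList (map g L)
  sumList-distrib f g []      = sym (+-identityˡ 0ℚ)
  sumList-distrib f g (x ∷ L) =
    trans (cong (f x + g x +_) (sumList-distrib f g L)) (interchange (f x) (g x) _ _)

  sumList-zero : (f : W → ℚ) (L : List W) → (∀ {x} → x ∈ L → f x ≡ 0ℚ) → sumList (map f L) ≡ 0ℚ
  sumList-zero f []      f≡0 = refl
  sumList-zero f (x ∷ L) f≡0 =
    trans (cong₂ _+_ (f≡0 (here refl)) (sumList-zero f L (f≡0 ∘ there))) (+-identityˡ 0ℚ)

  sumList-single : (f : W → ℚ) {L : List W} {q : W} → Unique L → q ∈ L →
                   (∀ {x} → x ∈ L → x ≢ q → f x ≡ 0ℚ) → sumList (map f L) ≡ f q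
  sumList-single f {q ∷ L} (q∉L ∷ _) (here refl) f≡0 =
    trans (cong (f q +_) (sumList-zero f L λ x∈L → f≡0 (there x∈L) (≢-sym (All.lookup q∉L x∈L))))
          (+-identityʳ (f q))
  sumList-single f {x ∷ L} (x∉L ∷ u) (there q∈L) f≡0 =
    trans (cong₂ _+_ (f≡0 (here refl) (All.lookup x∉L q∈L)) (sumList-single f u q∈L (f≡0 ∘ there)))
          (+-identityˡ (f _))

indicator : Bool → ℚ → ℚ
indicator b v = if b then v else 0ℚ

module _ {P : Set} (d : Dec P) (v : ℚ) where

  indicator-yes : P → indicator (does d) v ≡ v
  indicator-yes p = cong (λ b → indicator b v) (dec-true d p)

  indicator-no : ¬ P → indicator (does d) v ≡ 0ℚ
  indicator-no ¬p = cong (λ b → indicator b v) (dec-false d ¬p)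

module _ {W : Set} (_≟_ : DecidableEquality W) where

  open import Data.List.Membership.DecPropositional _≟_ using (_∈?_)

  sumList-indicator : {L : List W} → Unique L → (q : W) (v : ℚ) →
                      sumList (map (λ p → indicator (does (p ≟ q)) v) L) ≡ indicator (does (q ∈? L)) v
  sumList-indicator {L} u q v with q ∈? L
  ... | yes q∈L = trans (sumList-single _ u q∈L λ {x} _ x≢q → indicator-no (x ≟ q) v x≢q)
                        (indicator-yes (q ≟ q) v refl)
  ... | no  q∉L = sumList-zero _ L λ {x} x∈L → indicator-no (x ≟ q) v λ { refl → q∉L x∈L }

module _ {A : Set} where

  Unique-resp-↭ : {xs ys : List A} → xs ↭ ys → Unique xs → Unique ys
  Unique-resp-↭ xs↭ys = PermutationSetoid.Unique-resp-↭ (setoid A) (↭.↭⇒↭ₛ xs↭ys)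

  Unique-++⁻ : (xs : List A) {ys : List A} → Unique (xs ++ ys) →
               Unique xs × Unique ys × (∀ {v} → v ∈ xs → v ∉ ys)
  Unique-++⁻ []       u        = [] , u , λ ()
  Unique-++⁻ (x ∷ xs) (x∉ ∷ u) with Unique-++⁻ xs u
  ... | uxs , uys , disjoint = All.++⁻ˡ xs x∉ ∷ uxs , uys , λ
    { (here refl)  v∈ys → All.lookup (All.++⁻ʳ xs x∉) v∈ys refl
    ; (there v∈xs)      → disjoint v∈xs }

  Unique-map⇒injective : {B : Set} (f : A → B) {L : List A} → Unique (map f L) →
                         ∀ {p q} → p ∈ L → q ∈ L → f p ≡ f q → p ≡ q
  Unique-map⇒injective f (_ ∷ _)   (here refl) (here refl) _     = refl
  Unique-map⇒injective f (fp∉ ∷ _) (here refl) (there q∈)  fp≡fq =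
    contradiction fp≡fq (All.lookup fp∉ (∈-map⁺ f q∈))
  Unique-map⇒injective f (fq∉ ∷ _) (there p∈)  (here refl) fp≡fq =
    contradiction (sym fp≡fq) (All.lookup fq∉ (∈-map⁺ f p∈))
  Unique-map⇒injective f (_ ∷ u)   (there p∈)  (there q∈)  fp≡fq = Unique-map⇒injective f u p∈ q∈ fp≡fq

  ∈-─ : {x y : A} {xs : List A} (x∈ : x ∈ xs) → y ∈ xs → y ≢ x → y ∈ xs ─ x∈
  ∈-─ (here refl) (here refl) y≢x = contradiction refl y≢x
  ∈-─ (here refl) (there y∈)  _   = y∈
  ∈-─ (there x∈)  (here refl) _   = here refl
  ∈-─ (there x∈)  (there y∈)  y≢x = there (∈-─ x∈ y∈ y≢x)

  Unique⇒length≤ : {ys xs : List A} → Unique ys → (∀ {y} → y ∈ ys → y ∈ xs) → length ys ℕ.≤ length xs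
  Unique⇒length≤ []                       _     = z≤n
  Unique⇒length≤ {y ∷ ys} {xs} (y∉ys ∷ u) ys⊆xs =
    subst (suc (length ys) ℕ.≤_) (sym (length-removeAt′ xs (index y∈xs)))
          (s≤s (Unique⇒length≤ u λ y′∈ys →
            ∈-─ y∈xs (ys⊆xs (there y′∈ys)) (≢-sym (All.lookup y∉ys y′∈ys))))
    where
    y∈xs : y ∈ xs
    y∈xs = ys⊆xs (here refl)

  listsUpTo : ℕ → List A → List (List A)
  listsUpTo zero    xs = [] ∷ []
  listsUpTo (suc N) xs = [] ∷ cartesianProductWith _∷_ xs (listsUpTo N xs)

  ∈-listsUpTo : {xs : List A} → (∀ x → x ∈ xs) →
                (N : ℕ) (ys : List A) → length ys ℕ.≤ N → ys ∈ listsUpTo N xs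
  ∈-listsUpTo all∈ zero    []       _         = here refl
  ∈-listsUpTo all∈ (suc N) []       _         = here refl
  ∈-listsUpTo all∈ (suc N) (y ∷ ys) (s≤s len) =
    there (∈-cartesianProductWith⁺ _∷_ (all∈ y) (∈-listsUpTo all∈ N ys len))

  ∈-mapMaybe⁺ : {B : Set} (f : A → Maybe B) {x : A} {y : B} {xs : List A} →
                x ∈ xs → f x ≡ just y → y ∈ mapMaybe f xs
  ∈-mapMaybe⁺ f {xs = xs} x∈ fx≡just = Any.mapMaybe⁺ f xs
    (Any.map (λ fx≡z → subst (MaybeAny.Any _) (trans (sym fx≡just) fx≡z) (MaybeAny.just refl)) (∈-map⁺ f x∈))

allFin⊎ : (n k : ℕ) → List (Fin n ⊎ Fin k)
allFin⊎ n k = map inj₁ (allFin n) ++ map inj₂ (allFin k)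

∈-allFin⊎ : {n k : ℕ} (b : Fin n ⊎ Fin k) → b ∈ allFin⊎ n k
∈-allFin⊎ (inj₁ j) = ∈-++⁺ˡ (∈-map⁺ inj₁ (∈-allFin j))
∈-allFin⊎ (inj₂ d) = ∈-++⁺ʳ _ (∈-map⁺ inj₂ (∈-allFin d))

allFin⊎-unique : (n k : ℕ) → Unique (allFin⊎ n k)
allFin⊎-unique n k = Unique.++⁺ (Unique.map⁺ inj₁-injective (Unique.allFin⁺ n))
                                (Unique.map⁺ inj₂-injective (Unique.allFin⁺ k))
                                inj₁≢inj₂
  where
  inj₁≢inj₂ : ∀ {b} → ¬ (b ∈ map inj₁ (allFin n) × b ∈ map inj₂ (allFin k))
  inj₁≢inj₂ (b∈₁ , b∈₂) with ∈-map⁻ inj₁ b∈₁ | ∈-map⁻ inj₂ b∈₂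
  ... | _ , _ , refl | _ , _ , ()

sumFin-tabulate : (n : ℕ) (f : Fin n → ℚ) → sumFin n f ≡ sumList (tabulate f)
sumFin-tabulate zero    f = refl
sumFin-tabulate (suc n) f = cong (f zero +_) (sumFin-tabulate n (f ∘ suc))

sumFin-allFin : (n : ℕ) (f : Fin n → ℚ) → sumFin n f ≡ sumList (map f (allFin n))
sumFin-allFin n f = trans (sumFin-tabulate n f) (cong sumList (sym (map-tabulate id f)))

sumFin⊎-allFin⊎ : (n k : ℕ) (h : Fin n ⊎ Fin k → ℚ) →
                  sumFin n (h ∘ inj₁) + sumFin k (h ∘ inj₂) ≡ sumList (map h (allFin⊎ n k))
sumFin⊎-allFin⊎ n k h = begin
  sumFin n (h ∘ inj₁) + sumFin k (h ∘ inj₂)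
    ≡⟨ cong₂ _+_ (sumFin-allFin n (h ∘ inj₁)) (sumFin-allFin k (h ∘ inj₂)) ⟩
  sumList (map (h ∘ inj₁) (allFin n)) + sumList (map (h ∘ inj₂) (allFin k))
    ≡⟨ cong₂ (λ xs ys → sumList xs + sumList ys) (map-∘ (allFin n)) (map-∘ (allFin k)) ⟩
  sumList (map h (map inj₁ (allFin n))) + sumList (map h (map inj₂ (allFin k)))
    ≡⟨ sumList-++ (map h (map inj₁ (allFin n))) _ ⟨
  sumList (map h (map inj₁ (allFin n)) ++ map h (map inj₂ (allFin k)))
    ≡⟨ cong sumList (map-++ h (map inj₁ (allFin n)) _) ⟨
  sumList (map h (allFin⊎ n k)) ∎
  where open ≡-Reasoning

module _ {m n k : ℕ} where

  edgeSum : (Fin m → Fin n ⊎ Fin k → ℚ) → ℚ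
  edgeSum g = sumList (map (λ a → sumList (map (g a) (allFin⊎ n k))) (allFin m))

  matchWeight-edgeSum : (M : Fin m → Fin n ⊎ Fin k → Bool) (c : Fin m → Fin n ⊎ Fin k → ℚ) →
                        matchWeight M c ≡ edgeSum (λ a b → indicator (M a b) (c a b))
  matchWeight-edgeSum M c = trans (sumFin-allFin m _) (sumList-cong _ _ (allFin m)
    λ {a} _ → sumFin⊎-allFin⊎ n k (λ b → indicator (M a b) (c a b)))

  edgeSum-cong : (g h : Fin m → Fin n ⊎ Fin k → ℚ) → (∀ a b → g a b ≡ h a b) → edgeSum g ≡ edgeSum h
  edgeSum-cong g h g≗h = sumList-cong _ _ (allFin m) λ {a} _ →
    sumList-cong (g a) (h a) (allFin⊎ n k) λ {b} _ → g≗h a b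

  edgeSum-distrib : (g h : Fin m → Fin n ⊎ Fin k → ℚ) →
                    edgeSum (λ a b → g a b + h a b) ≡ edgeSum g + edgeSum h
  edgeSum-distrib g h = trans
    (sumList-cong _ _ (allFin m) λ {a} _ → sumList-distrib (g a) (h a) (allFin⊎ n k))
    (sumList-distrib _ _ (allFin m))

  edgeSum-zero : (g : Fin m → Fin n ⊎ Fin k → ℚ) → (∀ a b → g a b ≡ 0ℚ) → edgeSum g ≡ 0ℚ
  edgeSum-zero g g≡0 = sumList-zero _ (allFin m) λ {a} _ →
    sumList-zero (g a) (allFin⊎ n k) λ {b} _ → g≡0 a b

  edgeSum-single : (g : Fin m → Fin n ⊎ Fin k → ℚ) (a₀ : Fin m) (b₀ : Fin n ⊎ Fin k) →
                   (∀ a b → (a , b) ≢ (a₀ , b₀) → g a b ≡ 0ℚ) → edgeSum g ≡ g a₀ b₀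
  edgeSum-single g a₀ b₀ g≡0 = trans
    (sumList-single _ (Unique.allFin⁺ m) (∈-allFin a₀) λ {a} _ a≢a₀ →
      sumList-zero (g a) (allFin⊎ n k) λ {b} _ → g≡0 a b (a≢a₀ ∘ cong proj₁))
    (sumList-single (g a₀) (allFin⊎-unique n k) (∈-allFin⊎ b₀) λ {b} _ b≢b₀ →
      g≡0 a₀ b (b≢b₀ ∘ cong proj₂))

-- Cyclic sequences

module _ {V : Set} where

  pathPairs : V → List V → List (V × V)
  pathPairs x []      = []
  pathPairs x (y ∷ r) = (x , y) ∷ pathPairs y r

  pathEnd : V → List V → V
  pathEnd x []      = x
  pathEnd x (y ∷ r) = pathEnd y r

  private
    closedPath : (v : V) (g : V → List V → List (V × V)) →
                 (∀ x → g x [] ≡ (x , v) ∷ []) → (∀ x y r → g x (y ∷ r) ≡ (x , y) ∷ g y r) →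
                 ∀ x r → g x r ≡ pathPairs x (r ∷ʳ v)
    closedPath v g g-[] g-∷ x []      = g-[] x
    closedPath v g g-[] g-∷ x (y ∷ r) = trans (g-∷ x y r) (cong ((x , y) ∷_) (closedPath v g g-[] g-∷ y r))

  -- The local helper of `cyclePairs (v ∷ vs)` also takes `vs` as a hidden parameter; the
  -- `with`s separate that parameter from the helper's arguments, so that unification finds it.
  cyclePairs-∷ : (v : V) (vs : List V) → cyclePairs (v ∷ vs) ≡ pathPairs v (vs ∷ʳ v)
  cyclePairs-∷ v []      = refl
  cyclePairs-∷ v (y ∷ r) with y ∷ r
  ... | _ with closedPath v _ (λ _ → refl) (λ _ _ _ → refl) | y | r
  ...   | closed | x | s = cong ((v , x) ∷_) (closed x s)

  pathPairs-++ : (x z : V) (Q R : List V) → pathPairs x (Q ++ z ∷ R) ≡ pathPairs x (Q ∷ʳ z) ++ pathPairs z R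
  pathPairs-++ x z []      R = refl
  pathPairs-++ x z (q ∷ Q) R = cong ((x , q) ∷_) (pathPairs-++ q z Q R)

  pathPairs-∷ʳ : (x z : V) (Q : List V) → pathPairs x (Q ∷ʳ z) ≡ pathPairs x Q ++ (pathEnd x Q , z) ∷ []
  pathPairs-∷ʳ x z []      = refl
  pathPairs-∷ʳ x z (q ∷ Q) = cong ((x , q) ∷_) (pathPairs-∷ʳ q z Q)

  map-proj₁-pathPairs : (x z : V) (Q : List V) → map proj₁ (pathPairs x (Q ∷ʳ z)) ≡ x ∷ Q
  map-proj₁-pathPairs x z []      = refl
  map-proj₁-pathPairs x z (q ∷ Q) = cong (x ∷_) (map-proj₁-pathPairs q z Q)

  map-proj₂-pathPairs : (x : V) (Q : List V) → map proj₂ (pathPairs x Q) ≡ Q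
  map-proj₂-pathPairs x []      = refl
  map-proj₂-pathPairs x (q ∷ Q) = cong (q ∷_) (map-proj₂-pathPairs q Q)

  pathEnd-∈ : (x : V) (Q : List V) → pathEnd x Q ∈ x ∷ Q
  pathEnd-∈ x []      = here refl
  pathEnd-∈ x (q ∷ Q) = there (pathEnd-∈ q Q)

  pathEnd≡start⇒[] : (x : V) (Q : List V) → Unique (x ∷ Q) → pathEnd x Q ≡ x → Q ≡ []
  pathEnd≡start⇒[] x []      _            _   = refl
  pathEnd≡start⇒[] x (q ∷ Q) (x∉q∷Q ∷ _) end = contradiction (sym end) (All.lookup x∉q∷Q (pathEnd-∈ q Q))

  map-proj₁-cyclePairs : (vs : List V) → map proj₁ (cyclePairs vs) ≡ vs
  map-proj₁-cyclePairs []       = refl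
  map-proj₁-cyclePairs (v ∷ vs) = trans (cong (map proj₁) (cyclePairs-∷ v vs)) (map-proj₁-pathPairs v v vs)

  map-proj₂-cyclePairs : (vs : List V) → map proj₂ (cyclePairs vs) ↭ vs
  map-proj₂-cyclePairs []       = ↭.↭-refl
  map-proj₂-cyclePairs (v ∷ vs) = ↭.↭-trans
    (↭.↭-reflexive (trans (cong (map proj₂) (cyclePairs-∷ v vs)) (map-proj₂-pathPairs v (vs ∷ʳ v))))
    (↭.↭-sym (↭.∷↭∷ʳ v vs))

  ∈-cyclePairs-proj₁ : (vs : List V) {p : V × V} → p ∈ cyclePairs vs → proj₁ p ∈ vs
  ∈-cyclePairs-proj₁ vs p∈ = subst (_ ∈_) (map-proj₁-cyclePairs vs) (∈-map⁺ proj₁ p∈)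

  ∈-cyclePairs-proj₂ : (vs : List V) {p : V × V} → p ∈ cyclePairs vs → proj₂ p ∈ vs
  ∈-cyclePairs-proj₂ vs p∈ = ↭.∈-resp-↭ (map-proj₂-cyclePairs vs) (∈-map⁺ proj₂ p∈)

  cyclePairs-successor : (vs : List V) {x : V} → x ∈ vs → Σ[ y ∈ V ] (x , y) ∈ cyclePairs vs
  cyclePairs-successor vs x∈ with ∈-map⁻ proj₁ (subst (_ ∈_) (sym (map-proj₁-cyclePairs vs)) x∈)
  ... | (_ , y) , p∈ , refl = y , p∈

  cyclePairs-predecessor : (vs : List V) {x : V} → x ∈ vs → Σ[ y ∈ V ] (y , x) ∈ cyclePairs vs
  cyclePairs-predecessor vs x∈ with ∈-map⁻ proj₂ (↭.∈-resp-↭ (↭.↭-sym (map-proj₂-cyclePairs vs)) x∈)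
  ... | (y , _) , p∈ , refl = y , p∈

  cyclePairs-unique : (vs : List V) → Unique vs → Unique (cyclePairs vs)
  cyclePairs-unique vs u = Unique.map⁻ (subst Unique (sym (map-proj₁-cyclePairs vs)) u)

  cyclePairs-proj₁-injective : (vs : List V) → Unique vs → ∀ {p q} →
    p ∈ cyclePairs vs → q ∈ cyclePairs vs → proj₁ p ≡ proj₁ q → p ≡ q
  cyclePairs-proj₁-injective vs u =
    Unique-map⇒injective proj₁ (subst Unique (sym (map-proj₁-cyclePairs vs)) u)

  cyclePairs-proj₂-injective : (vs : List V) → Unique vs → ∀ {p q} →
    p ∈ cyclePairs vs → q ∈ cyclePairs vs → proj₂ p ≡ proj₂ q → p ≡ q
  cyclePairs-proj₂-injective vs u =
    Unique-map⇒injective proj₂ (Unique-resp-↭ (↭.↭-sym (map-proj₂-cyclePairs vs)) u)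

  cyclePairs-split : (x z : V) (Q R : List V) →
                     cyclePairs (x ∷ Q ++ z ∷ R) ≡ pathPairs x (Q ∷ʳ z) ++ pathPairs z (R ∷ʳ x)
  cyclePairs-split x z Q R = begin
    cyclePairs (x ∷ Q ++ z ∷ R)                   ≡⟨ cyclePairs-∷ x (Q ++ z ∷ R) ⟩
    pathPairs x ((Q ++ z ∷ R) ∷ʳ x)               ≡⟨ cong (pathPairs x) (++-assoc Q (z ∷ R) (x ∷ [])) ⟩
    pathPairs x (Q ++ z ∷ R ∷ʳ x)                 ≡⟨ pathPairs-++ x z Q (R ∷ʳ x) ⟩
    pathPairs x (Q ∷ʳ z) ++ pathPairs z (R ∷ʳ x)  ∎
    where open ≡-Reasoning

  cyclePairs-rotate : (P T : List V) → cyclePairs (P ++ T) ↭ cyclePairs (T ++ P)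
  cyclePairs-rotate []      T       = ↭.↭-reflexive (cong cyclePairs (sym (++-identityʳ T)))
  cyclePairs-rotate (x ∷ Q) []      = ↭.↭-reflexive (cong cyclePairs (++-identityʳ (x ∷ Q)))
  cyclePairs-rotate (x ∷ Q) (z ∷ R) = begin
    cyclePairs (x ∷ Q ++ z ∷ R)                   ≡⟨ cyclePairs-split x z Q R ⟩
    pathPairs x (Q ∷ʳ z) ++ pathPairs z (R ∷ʳ x)  ↭⟨ ↭.++-comm (pathPairs x (Q ∷ʳ z)) _ ⟩
    pathPairs z (R ∷ʳ x) ++ pathPairs x (Q ∷ʳ z)  ≡⟨ cyclePairs-split z x R Q ⟨
    cyclePairs (z ∷ R ++ x ∷ Q)                   ∎
    where open ↭.PermutationReasoning

module _ {A B : Set} {F M : A → B → Bool} (pm : IsPerfectMatching F M) where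

  partnerᴬ-unique : ∀ b {a a′} → M a b ≡ true → M a′ b ≡ true → a ≡ a′
  partnerᴬ-unique b Mab Ma′b = let (_ , _ , uniq) = proj₂ (proj₂ pm) b in trans (uniq _ Mab) (sym (uniq _ Ma′b))

  partnerᴮ-unique : ∀ a {b b′} → M a b ≡ true → M a b′ ≡ true → b ≡ b′
  partnerᴮ-unique a Mab Mab′ = let (_ , _ , uniq) = proj₁ (proj₂ pm) a in trans (uniq _ Mab) (sym (uniq _ Mab′))

module _ {A B : Set} {M N : A → B → Bool} where

  ExactlyOneB-cong : {a : A} → (∀ b → M a b ≡ N a b) → ExactlyOneB M a → ExactlyOneB N a
  ExactlyOneB-cong M≗N (b , Mab , uniq) =
    b , trans (sym (M≗N b)) Mab , λ b′ Nab′ → uniq b′ (trans (M≗N b′) Nab′)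

  ExactlyOneA-cong : {b : B} → (∀ a → M a b ≡ N a b) → ExactlyOneA M b → ExactlyOneA N b
  ExactlyOneA-cong M≗N (a , Mab , uniq) =
    a , trans (sym (M≗N a)) Mab , λ a′ Na′b → uniq a′ (trans (M≗N a′) Na′b)

module _ {A B : Set} (F M : A → B → Bool) where

  IsCycle : List (A ⊎ B) → Set
  IsCycle vs = Unique vs × All (λ p → Arc F M (proj₁ p) (proj₂ p)) (cyclePairs vs)

  toDirCycle : (v : A ⊎ B) (vs : List (A ⊎ B)) → IsCycle (v ∷ vs) → DirCycle F M
  toDirCycle v vs (u , as) = record { verts = v ∷ vs ; nonempty = λ () ; distinct = u ; arcs = as }

  IsCycle-rotate : (P T : List (A ⊎ B)) → IsCycle (P ++ T) → IsCycle (T ++ P)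
  IsCycle-rotate P T (u , as) = Unique-resp-↭ (↭.++-comm P T) u , ↭.All-resp-↭ (cyclePairs-rotate P T) as

module _ {A B : Set} (M : A → B → Bool) (c : A → B → ℚ) where

  walkWeight : List ((A ⊎ B) × (A ⊎ B)) → ℚ
  walkWeight ps = sumList (map (λ p → arcWeight M c (proj₁ p) (proj₂ p)) ps)

  walkWeight-++ : (ps qs : List ((A ⊎ B) × (A ⊎ B))) → walkWeight (ps ++ qs) ≡ walkWeight ps + walkWeight qs
  walkWeight-++ ps qs = trans (cong sumList (map-++ _ ps qs)) (sumList-++ (map _ ps) (map _ qs))

  cyclicWeight : List (A ⊎ B) → ℚ
  cyclicWeight vs = walkWeight (cyclePairs vs)

  cyclicWeight-rotate : (P T : List (A ⊎ B)) → cyclicWeight (P ++ T) ≡ cyclicWeight (T ++ P)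
  cyclicWeight-rotate P T = sumList-↭ (↭.map⁺ _ (cyclePairs-rotate P T))

-- Symmetric difference of a perfect matching with a cycle of H_μ

_≟ᵥ_ : {m n k : ℕ} → DecidableEquality (Fin m ⊎ (Fin n ⊎ Fin k))
_≟ᵥ_ = ⊎-≡-dec _≟Fin_ (⊎-≡-dec _≟Fin_ _≟Fin_)

module SymmetricDifference {m n k : ℕ} (F μ : Fin m → Fin n ⊎ Fin k → Bool)
                           (c : Fin m → Fin n ⊎ Fin k → ℚ) where

  private
    B V : Set
    B = Fin n ⊎ Fin k
    V = Fin m ⊎ B

    _≟_ : DecidableEquality (V × V)
    _≟_ = ×-≡-dec _≟ᵥ_ _≟ᵥ_

  open import Data.List.Membership.DecPropositional _≟_ using (_∈?_)
  open import Data.List.Membership.DecPropositional (_≟ᵥ_ {m} {n} {k}) using () renaming (_∈?_ to _∈ᵥ?_)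

  edgeArc matchArc : Fin m → B → V × V
  edgeArc  a b = inj₁ a , inj₂ b
  matchArc a b = inj₂ b , inj₁ a

  arcWeightOf : V × V → ℚ
  arcWeightOf p = arcWeight μ c (proj₁ p) (proj₂ p)

  -- Spreads the weight of an arc over the edges of G′, so that weights of walks and of
  -- matchings become sums over the same index set.
  arcShare : V × V → Fin m → B → ℚ
  arcShare p a b = indicator (does (p ≟ edgeArc a b)) (c a b) + indicator (does (p ≟ matchArc a b)) (- c a b)

  arcShare-off : (p : V × V) (a : Fin m) (b : B) → p ≢ edgeArc a b → p ≢ matchArc a b → arcShare p a b ≡ 0ℚ
  arcShare-off p a b ≢edge ≢match =
    trans (cong₂ _+_ (indicator-no (p ≟ edgeArc a b) _ ≢edge) (indicator-no (p ≟ matchArc a b) _ ≢match))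
          (+-identityˡ 0ℚ)

  edgeSum-arcShare : (p : V × V) → edgeSum (arcShare p) ≡ arcWeightOf p
  edgeSum-arcShare p@(inj₁ a₀ , inj₂ b₀) = trans
    (edgeSum-single (arcShare p) a₀ b₀ λ a b ab≢ → arcShare-off p a b (λ { refl → ab≢ refl }) λ ())
    (trans (cong₂ _+_ (indicator-yes (p ≟ p) (c a₀ b₀) refl)
                      (indicator-no (p ≟ matchArc a₀ b₀) (- c a₀ b₀) λ ()))
           (+-identityʳ (c a₀ b₀)))
  edgeSum-arcShare p@(inj₂ b₀ , inj₁ a₀) = trans
    (edgeSum-single (arcShare p) a₀ b₀ λ a b ab≢ → arcShare-off p a b (λ ()) λ { refl → ab≢ refl })
    (trans (cong₂ _+_ (indicator-no (p ≟ edgeArc a₀ b₀) (c a₀ b₀) λ ())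
                      (indicator-yes (p ≟ p) (- c a₀ b₀) refl))
           (+-identityˡ (- c a₀ b₀)))
  edgeSum-arcShare p@(inj₁ _ , inj₁ _) = edgeSum-zero (arcShare p) λ a b → arcShare-off p a b (λ ()) (λ ())
  edgeSum-arcShare p@(inj₂ _ , inj₂ _) = edgeSum-zero (arcShare p) λ a b → arcShare-off p a b (λ ()) (λ ())

  walkWeight-edgeSum : (L : List (V × V)) →
                       walkWeight μ c L ≡ edgeSum (λ a b → sumList (map (λ p → arcShare p a b) L))
  walkWeight-edgeSum []      = sym (edgeSum-zero (λ (_ : Fin m) (_ : B) → 0ℚ) λ _ _ → refl)
  walkWeight-edgeSum (p ∷ L) = trans (cong₂ _+_ (sym (edgeSum-arcShare p)) (walkWeight-edgeSum L))
                                     (sym (edgeSum-distrib (arcShare p) _))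

  sumList-arcShare : {L : List (V × V)} → Unique L → (a : Fin m) (b : B) →
    sumList (map (λ p → arcShare p a b) L) ≡
    indicator (does (edgeArc a b ∈? L)) (c a b) + indicator (does (matchArc a b ∈? L)) (- c a b)
  sumList-arcShare {L} u a b = trans (sumList-distrib _ _ L)
    (cong₂ _+_ (sumList-indicator _≟_ u (edgeArc a b) (c a b)) (sumList-indicator _≟_ u (matchArc a b) (- c a b)))

  module _ (pm : IsPerfectMatching F μ) (C : DirCycle F μ) where

    private
      cp : List (V × V)
      cp = cyclePairs (verts C)

      arcOf : ∀ {p} → p ∈ cp → Arc F μ (proj₁ p) (proj₂ p)
      arcOf = All.lookup (arcs C)

    symDiff : Fin m → B → Bool
    symDiff a b with edgeArc a b ∈? cp | matchArc a b ∈? cp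
    ... | yes _ | _     = true
    ... | no  _ | yes _ = false
    ... | no  _ | no  _ = μ a b

    symDiff-off : ∀ a b → edgeArc a b ∉ cp → matchArc a b ∉ cp → symDiff a b ≡ μ a b
    symDiff-off a b ∉edge ∉match with edgeArc a b ∈? cp | matchArc a b ∈? cp
    ... | yes e | _     = contradiction e ∉edge
    ... | no  _ | yes m = contradiction m ∉match
    ... | no  _ | no  _ = refl

    symDiff-edgeArc : ∀ a b → edgeArc a b ∈ cp → symDiff a b ≡ true
    symDiff-edgeArc a b e with edgeArc a b ∈? cp
    ... | yes _ = refl
    ... | no ∉e = contradiction e ∉e

    symDiff-true⇒ : ∀ a b → symDiff a b ≡ true → edgeArc a b ∈ cp ⊎ (matchArc a b ∉ cp × μ a b ≡ true)
    symDiff-true⇒ a b ν≡true with edgeArc a b ∈? cp | matchArc a b ∈? cp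
    ... | yes e | _     = inj₁ e
    ... | no  _ | no ∉m = inj₂ (∉m , ν≡true)

    symDiff⊆F : ∀ a b → symDiff a b ≡ true → F a b ≡ true
    symDiff⊆F a b ν≡true with symDiff-true⇒ a b ν≡true
    ... | inj₁ e         = proj₁ (arcOf e)
    ... | inj₂ (_ , μab) = proj₁ pm a b μab

    symDiff-exactlyOneᴮ : ∀ a → ExactlyOneB symDiff a
    symDiff-exactlyOneᴮ a with inj₁ a ∈ᵥ? verts C
    ... | no a∉ = ExactlyOneB-cong {M = μ} {N = symDiff}
                    (λ b → sym (symDiff-off a b (a∉ ∘ ∈-cyclePairs-proj₁ (verts C))
                                                (a∉ ∘ ∈-cyclePairs-proj₂ (verts C))))
                    (proj₁ (proj₂ pm) a)
    ... | yes a∈ with cyclePairs-successor (verts C) a∈ | cyclePairs-predecessor (verts C) a∈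
    ...   | inj₁ _ , e | _          = ⊥-elim (arcOf e)
    ...   | _          | inj₁ _ , m = ⊥-elim (arcOf m)
    ...   | inj₂ b , e | inj₂ _ , m = b , symDiff-edgeArc a b e , uniq
      where
      uniq : ∀ b′ → symDiff a b′ ≡ true → b′ ≡ b
      uniq b′ ν≡true with symDiff-true⇒ a b′ ν≡true
      ... | inj₁ e′          =
        inj₂-injective (cong proj₂ (cyclePairs-proj₁-injective (verts C) (distinct C) e′ e refl))
      ... | inj₂ (∉m , μab′) =
        contradiction (subst (λ b → matchArc a b ∈ cp) (partnerᴮ-unique pm a (arcOf m) μab′) m) ∉m

    symDiff-exactlyOneᴬ : ∀ b → ExactlyOneA symDiff b
    symDiff-exactlyOneᴬ b with inj₂ b ∈ᵥ? verts C
    ... | no b∉ = ExactlyOneA-cong {M = μ} {N = symDiff}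
                    (λ a → sym (symDiff-off a b (b∉ ∘ ∈-cyclePairs-proj₂ (verts C))
                                                (b∉ ∘ ∈-cyclePairs-proj₁ (verts C))))
                    (proj₂ (proj₂ pm) b)
    ... | yes b∈ with cyclePairs-predecessor (verts C) b∈ | cyclePairs-successor (verts C) b∈
    ...   | inj₂ _ , e | _          = ⊥-elim (arcOf e)
    ...   | _          | inj₂ _ , m = ⊥-elim (arcOf m)
    ...   | inj₁ a , e | inj₁ _ , m = a , symDiff-edgeArc a b e , uniq
      where
      uniq : ∀ a′ → symDiff a′ b ≡ true → a′ ≡ a
      uniq a′ ν≡true with symDiff-true⇒ a′ b ν≡true
      ... | inj₁ e′          =
        inj₁-injective (cong proj₁ (cyclePairs-proj₂-injective (verts C) (distinct C) e′ e refl))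
      ... | inj₂ (∉m , μa′b) =
        contradiction (subst (λ a → matchArc a b ∈ cp) (partnerᴬ-unique pm b (arcOf m) μa′b) m) ∉m

    symDiff-perfect : IsPerfectMatching F symDiff
    symDiff-perfect = symDiff⊆F , symDiff-exactlyOneᴮ , symDiff-exactlyOneᴬ

    symDiff-indicator : ∀ a b → indicator (symDiff a b) (c a b) ≡
                                indicator (μ a b) (c a b) + sumList (map (λ p → arcShare p a b) cp)
    symDiff-indicator a b = trans (byCases a b)
      (cong (indicator (μ a b) (c a b) +_) (sym (sumList-arcShare (cyclePairs-unique (verts C) (distinct C)) a b)))
      where
      open ≡-Reasoning
      byCases : ∀ a b → indicator (symDiff a b) (c a b) ≡ indicator (μ a b) (c a b) +
                  (indicator (does (edgeArc a b ∈? cp)) (c a b) + indicator (does (matchArc a b ∈? cp)) (- c a b))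
      byCases a b with edgeArc a b ∈? cp | matchArc a b ∈? cp
      ... | yes e | yes m = contradiction (trans (sym (arcOf m)) (proj₂ (arcOf e))) λ ()
      ... | yes e | no _  = begin
        c a b                                      ≡⟨ +-identityʳ (c a b) ⟨
        c a b + 0ℚ                                 ≡⟨ +-identityˡ (c a b + 0ℚ) ⟨
        0ℚ + (c a b + 0ℚ)                          ≡⟨ cong (λ x → indicator x (c a b) + (c a b + 0ℚ)) (proj₂ (arcOf e)) ⟨
        indicator (μ a b) (c a b) + (c a b + 0ℚ)   ∎
      ... | no _  | yes m = begin
        0ℚ                                         ≡⟨ +-inverseʳ (c a b) ⟨
        c a b + - c a b                            ≡⟨ cong (c a b +_) (+-identityˡ (- c a b)) ⟨
        c a b + (0ℚ + - c a b)                     ≡⟨ cong (λ x → indicator x (c a b) + (0ℚ + - c a b)) (arcOf m) ⟨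
        indicator (μ a b) (c a b) + (0ℚ + - c a b) ∎
      ... | no _  | no _  = sym (trans (cong (indicator (μ a b) (c a b) +_) (+-identityˡ 0ℚ)) (+-identityʳ _))

    symDiff-weight : matchWeight symDiff c ≡ matchWeight μ c + cycleWeight c C
    symDiff-weight = begin
      matchWeight symDiff c
        ≡⟨ matchWeight-edgeSum symDiff c ⟩
      edgeSum (λ a b → indicator (symDiff a b) (c a b))
        ≡⟨ edgeSum-cong (λ a b → indicator (symDiff a b) (c a b)) _ symDiff-indicator ⟩
      edgeSum (λ a b → indicator (μ a b) (c a b) + sumList (map (λ p → arcShare p a b) cp))
        ≡⟨ edgeSum-distrib (λ a b → indicator (μ a b) (c a b))
                           (λ a b → sumList (map (λ p → arcShare p a b) cp)) ⟩
      edgeSum (λ a b → indicator (μ a b) (c a b)) + edgeSum (λ a b → sumList (map (λ p → arcShare p a b) cp))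
        ≡⟨ cong₂ _+_ (matchWeight-edgeSum μ c) (walkWeight-edgeSum cp) ⟨
      matchWeight μ c + cycleWeight c C ∎
      where open ≡-Reasoning

  minimal⇒nonnegativeCycle : IsPerfectMatching F μ →
    (∀ ν → IsPerfectMatching F ν → matchWeight μ c ≤ matchWeight ν c) →
    (C : DirCycle F μ) → 0ℚ ≤ cycleWeight c C
  minimal⇒nonnegativeCycle pm minimal C = x≤x+y⇒0≤y _ _
    (subst (matchWeight μ c ≤_) (symDiff-weight pm C) (minimal (symDiff pm C) (symDiff-perfect pm C)))

-- Existence of a minimum-weight cycle

module MinimumCycle {m n k : ℕ} (F M : Fin m → Fin n ⊎ Fin k → Bool)
                    (c : Fin m → Fin n ⊎ Fin k → ℚ) where

  private
    V : Set
    V = Fin m ⊎ (Fin n ⊎ Fin k)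

  allVertices : List V
  allVertices = map inj₁ (allFin m) ++ map inj₂ (allFin⊎ n k)

  ∈-allVertices : (x : V) → x ∈ allVertices
  ∈-allVertices (inj₁ a) = ∈-++⁺ˡ (∈-map⁺ inj₁ (∈-allFin a))
  ∈-allVertices (inj₂ b) = ∈-++⁺ʳ _ (∈-map⁺ inj₂ (∈-allFin⊎ b))

  arc? : (p : V × V) → Dec (Arc F M (proj₁ p) (proj₂ p))
  arc? (inj₁ a , inj₂ b) = (F a b Bool.≟ true) ×-dec (M a b Bool.≟ false)
  arc? (inj₂ b , inj₁ a) = M a b Bool.≟ true
  arc? (inj₁ _ , inj₁ _) = no λ ()
  arc? (inj₂ _ , inj₂ _) = no λ ()

  toCycle : List V → Maybe (DirCycle F M)
  toCycle []       = nothing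
  toCycle (v ∷ vs) with unique? _≟ᵥ_ (v ∷ vs) | All.all? arc? (cyclePairs (v ∷ vs))
  ... | yes u | yes as = just (toDirCycle F M v vs (u , as))
  ... | _     | _      = nothing

  toCycle-complete : (C : DirCycle F M) →
                     Σ[ C′ ∈ DirCycle F M ] toCycle (verts C) ≡ just C′ × verts C′ ≡ verts C
  toCycle-complete C = complete (verts C) (nonempty C) (distinct C , arcs C)
    where
    complete : (vs : List V) → vs ≢ [] → IsCycle F M vs →
               Σ[ C′ ∈ DirCycle F M ] toCycle vs ≡ just C′ × verts C′ ≡ vs
    complete []       vs≢[] _        = contradiction refl vs≢[]
    complete (v ∷ vs) _     (u , as) with unique? _≟ᵥ_ (v ∷ vs) | All.all? arc? (cyclePairs (v ∷ vs))
    ... | yes _ | yes _  = _ , refl , refl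
    ... | no ¬u | _      = contradiction u ¬u
    ... | yes _ | no ¬as = contradiction as ¬as

  minimumCycle : DirCycle F M → Σ[ C ∈ DirCycle F M ] (∀ D → cycleWeight c C ≤ cycleWeight c D)
  minimumCycle C₀ = argmin (cycleWeight c) C₀ candidates , isMinimum
    where
    candidates : List (DirCycle F M)
    candidates = mapMaybe toCycle (listsUpTo (length allVertices) allVertices)

    isMinimum : ∀ D → cycleWeight c (argmin (cycleWeight c) C₀ candidates) ≤ cycleWeight c D
    isMinimum D with toCycle-complete D
    ... | D′ , toCycle≡D′ , verts≡ = subst (_ ≤_) (cong (cyclicWeight M c) verts≡)
      (All.lookup (f[argmin]≤f[xs] C₀ candidates) (∈-mapMaybe⁺ toCycle
        (∈-listsUpTo ∈-allVertices _ (verts D) (Unique⇒length≤ (distinct D) λ {y} _ → ∈-allVertices y))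
        toCycle≡D′))

-- Cycles of G′_μ′ through the dummy vertices

realVertex : {m n k : ℕ} → Fin m ⊎ Fin n → Fin m ⊎ (Fin n ⊎ Fin k)
realVertex (inj₁ a) = inj₁ a
realVertex (inj₂ j) = inj₂ (inj₁ j)

avoiding⇒¬Incident : {m n k : ℕ} (s : Fin m ⊎ Fin n) (vs : List (Fin m ⊎ (Fin n ⊎ Fin k))) → realVertex s ∉ vs →
                     ∀ {a b} → inj₁ a ∈ vs → inj₂ b ∈ vs → ¬ Incident s a b
avoiding⇒¬Incident (inj₁ _) vs s∉ a∈ b∈ refl = s∉ a∈
avoiding⇒¬Incident (inj₂ _) vs s∉ a∈ b∈ refl = s∉ b∈

module DummyVertices {m n k : ℕ} (E : Fin m → Fin n → Bool) (w : Fin m → Fin n → ℚ)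
  (μ : Fin m → Fin n ⊎ Fin k → Bool) (pm : IsPerfectMatching (extEdges E) μ)
  (minimal : ∀ (ν : Fin m → Fin n ⊎ Fin k → Bool) → IsPerfectMatching (extEdges E) ν →
             matchWeight μ (extWeights w) ≤ matchWeight ν (extWeights w))
  (s : Fin m ⊎ Fin n) (w̃ : Fin m → Fin n ⊎ Fin k → ℚ)
  (w̃≡w : ∀ a b → extEdges E a b ≡ true → ¬ Incident s a b → w̃ a b ≡ extWeights w a b)
  (w̃-dummy : ∀ a d → w̃ a (inj₂ d) ≡ 0ℚ) where

  private
    V : Set
    V = Fin m ⊎ (Fin n ⊎ Fin k)

    F : Fin m → Fin n ⊎ Fin k → Bool
    F = extEdges E

    Cycle : Set
    Cycle = DirCycle F μ

    IsArc : V × V → Set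
    IsArc p = Arc F μ (proj₁ p) (proj₂ p)

  open import Data.List.Membership.DecPropositional (_≟ᵥ_ {m} {n} {k}) using () renaming (_∈?_ to _∈ᵥ?_)

  dummy : Fin k → V
  dummy d = inj₂ (inj₂ d)

  arcWeight-intoDummy : ∀ x d → arcWeight μ w̃ x (dummy d) ≡ 0ℚ
  arcWeight-intoDummy (inj₁ a) d = w̃-dummy a d
  arcWeight-intoDummy (inj₂ _) d = refl

  arcIntoDummy-source : ∀ x d → IsArc (x , dummy d) → Σ[ a ∈ Fin m ] x ≡ inj₁ a
  arcIntoDummy-source (inj₁ a) d _ = a , refl

  dummyCount-++ : (xs ys : List V) → dummyCount (xs ++ ys) ≡ dummyCount xs ℕ.+ dummyCount ys
  dummyCount-++ []                   ys = refl
  dummyCount-++ (inj₁ _ ∷ xs)        ys = dummyCount-++ xs ys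
  dummyCount-++ (inj₂ (inj₁ _) ∷ xs) ys = dummyCount-++ xs ys
  dummyCount-++ (inj₂ (inj₂ _) ∷ xs) ys = cong suc (dummyCount-++ xs ys)

  dummyCount-rotate : (P T : List V) → dummyCount (P ++ T) ≡ dummyCount (T ++ P)
  dummyCount-rotate P T =
    trans (dummyCount-++ P T) (trans (ℕ.+-comm (dummyCount P) (dummyCount T)) (sym (dummyCount-++ T P)))

  cycleWeight-avoiding-s : (C : Cycle) → realVertex s ∉ verts C → cycleWeight w̃ C ≡ cycleWeight (extWeights w) C
  cycleWeight-avoiding-s C s∉ = sumList-cong _ _ (cyclePairs (verts C)) λ p∈ →
    agree _ (All.lookup (arcs C) p∈) (∈-cyclePairs-proj₁ (verts C) p∈) (∈-cyclePairs-proj₂ (verts C) p∈)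
    where
    agree : (p : V × V) → IsArc p → proj₁ p ∈ verts C → proj₂ p ∈ verts C →
            arcWeight μ w̃ (proj₁ p) (proj₂ p) ≡ arcWeight μ (extWeights w) (proj₁ p) (proj₂ p)
    agree (inj₁ a , inj₂ b) (Fab , _) a∈ b∈ = w̃≡w a b Fab (avoiding⇒¬Incident s (verts C) s∉ a∈ b∈)
    agree (inj₂ b , inj₁ a) μab       b∈ a∈ =
      cong -_ (w̃≡w a b (proj₁ pm a b μab) (avoiding⇒¬Incident s (verts C) s∉ a∈ b∈))

  nonnegative-avoiding-s : (C : Cycle) → realVertex s ∉ verts C → 0ℚ ≤ cycleWeight w̃ C
  nonnegative-avoiding-s C s∉ = subst (0ℚ ≤_) (sym (cycleWeight-avoiding-s C s∉))
    (SymmetricDifference.minimal⇒nonnegativeCycle F μ (extWeights w) pm minimal C)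

  walkWeight-intoDummy : (x : V) (Q : List V) (d : Fin k) →
                         walkWeight μ w̃ (pathPairs x (Q ∷ʳ dummy d)) ≡ walkWeight μ w̃ (pathPairs x Q)
  walkWeight-intoDummy x Q d = begin
    walkWeight μ w̃ (pathPairs x (Q ∷ʳ dummy d))
      ≡⟨ cong (walkWeight μ w̃) (pathPairs-∷ʳ x (dummy d) Q) ⟩
    walkWeight μ w̃ (pathPairs x Q ++ (pathEnd x Q , dummy d) ∷ [])
      ≡⟨ walkWeight-++ μ w̃ (pathPairs x Q) _ ⟩
    walkWeight μ w̃ (pathPairs x Q) + (arcWeight μ w̃ (pathEnd x Q) (dummy d) + 0ℚ)
      ≡⟨ cong (λ y → walkWeight μ w̃ (pathPairs x Q) + (y + 0ℚ)) (arcWeight-intoDummy (pathEnd x Q) d) ⟩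
    walkWeight μ w̃ (pathPairs x Q) + (0ℚ + 0ℚ)
      ≡⟨ +-identityʳ _ ⟩
    walkWeight μ w̃ (pathPairs x Q) ∎
    where open ≡-Reasoning

  -- Such a walk is the single matching arc from `dummy d` back to its partner `a`.
  walkToPartner≡0 : (d : Fin k) (Q : List V) (a : Fin m) →
                    Unique (dummy d ∷ Q) → All IsArc (pathPairs (dummy d) Q) →
                    pathEnd (dummy d) Q ≡ inj₁ a → μ a (inj₂ d) ≡ true →
                    walkWeight μ w̃ (pathPairs (dummy d) Q) ≡ 0ℚ
  walkToPartner≡0 d []            a _       _          ()  _
  walkToPartner≡0 d (inj₂ _ ∷ Q)  a _       (() ∷ _)   _   _
  walkToPartner≡0 d (inj₁ a₁ ∷ Q) a (_ ∷ u) (μa₁d ∷ _) end μad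
    with pathEnd≡start⇒[] (inj₁ a₁) Q u (trans end (cong inj₁ (partnerᴬ-unique pm (inj₂ d) μad μa₁d)))
  ... | refl = cong (λ x → - x + 0ℚ) (w̃-dummy a₁ d)

  dummyWalkWeight : Fin k → List V → Fin k → ℚ
  dummyWalkWeight d Q d′ = walkWeight μ w̃ (pathPairs (dummy d) (Q ∷ʳ dummy d′))

  ClosesOrVanishes : Fin k → List V → Fin k → Set
  ClosesOrVanishes d Q d′ =
    (IsCycle F μ (dummy d ∷ Q) × cyclicWeight μ w̃ (dummy d ∷ Q) ≡ dummyWalkWeight d Q d′) ⊎
    dummyWalkWeight d Q d′ ≡ 0ℚ

  -- Redirecting the last arc of the walk from `dummy d′` to `dummy d` keeps its weight 0; the
  -- new arc exists unless the last vertex of Q is the partner of `dummy d`.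
  closeWalk : (d d′ : Fin k) (Q : List V) →
              Unique (dummy d ∷ Q) → All IsArc (pathPairs (dummy d) (Q ∷ʳ dummy d′)) →
              ClosesOrVanishes d Q d′
  closeWalk d d′ Q u as
    with All.++⁻ (pathPairs (dummy d) Q) (subst (All IsArc) (pathPairs-∷ʳ (dummy d) (dummy d′) Q) as)
  ... | asQ , lastArc ∷ [] with arcIntoDummy-source _ d′ lastArc
  ...   | a , end with μ a (inj₂ d) in μad
  ...     | true  = inj₂ (trans (walkWeight-intoDummy (dummy d) Q d′) (walkToPartner≡0 d Q a u asQ end μad))
  ...     | false = inj₁ ((u , closedArcs) , closedWeight)
    where
    closedArcs : All IsArc (cyclePairs (dummy d ∷ Q))
    closedArcs = subst (All IsArc) (sym (trans (cyclePairs-∷ (dummy d) Q) (pathPairs-∷ʳ (dummy d) (dummy d) Q)))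
                       (All.++⁺ asQ (subst (λ x → IsArc (x , dummy d)) (sym end) (refl , μad) ∷ []))

    closedWeight : cyclicWeight μ w̃ (dummy d ∷ Q) ≡ dummyWalkWeight d Q d′
    closedWeight = trans (cong (walkWeight μ w̃) (cyclePairs-∷ (dummy d) Q))
                         (trans (walkWeight-intoDummy (dummy d) Q d) (sym (walkWeight-intoDummy (dummy d) Q d′)))

  splitAtDummies : (d₁ d₂ : Fin k) (Q R : List V) → IsCycle F μ (dummy d₁ ∷ Q ++ dummy d₂ ∷ R) →
                   cyclicWeight μ w̃ (dummy d₁ ∷ Q ++ dummy d₂ ∷ R) < 0ℚ →
                   Σ[ C ∈ Cycle ] cycleWeight w̃ C ≤ cyclicWeight μ w̃ (dummy d₁ ∷ Q ++ dummy d₂ ∷ R) ×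
                                  dummyCount (verts C) ℕ.< dummyCount (dummy d₁ ∷ Q ++ dummy d₂ ∷ R)
  splitAtDummies d₁ d₂ Q R (u , as) negative = pick (closeWalk d₁ d₂ Q u₁ as₁) (closeWalk d₂ d₁ R u₂ as₂)
    where
    vs : List V
    vs = dummy d₁ ∷ Q ++ dummy d₂ ∷ R

    h₁ h₂ : ℚ
    h₁ = dummyWalkWeight d₁ Q d₂
    h₂ = dummyWalkWeight d₂ R d₁

    u₁ : Unique (dummy d₁ ∷ Q)
    u₁ = proj₁ (Unique-++⁻ (dummy d₁ ∷ Q) u)

    u₂ : Unique (dummy d₂ ∷ R)
    u₂ = proj₁ (proj₂ (Unique-++⁻ (dummy d₁ ∷ Q) u))

    disjoint : ∀ {v} → v ∈ dummy d₁ ∷ Q → v ∉ dummy d₂ ∷ R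
    disjoint = proj₂ (proj₂ (Unique-++⁻ (dummy d₁ ∷ Q) u))

    as₁₂ : All IsArc (pathPairs (dummy d₁) (Q ∷ʳ dummy d₂) ++ pathPairs (dummy d₂) (R ∷ʳ dummy d₁))
    as₁₂ = subst (All IsArc) (cyclePairs-split (dummy d₁) (dummy d₂) Q R) as

    as₁ : All IsArc (pathPairs (dummy d₁) (Q ∷ʳ dummy d₂))
    as₁ = All.++⁻ˡ _ as₁₂

    as₂ : All IsArc (pathPairs (dummy d₂) (R ∷ʳ dummy d₁))
    as₂ = All.++⁻ʳ (pathPairs (dummy d₁) (Q ∷ʳ dummy d₂)) as₁₂

    total : cyclicWeight μ w̃ vs ≡ h₁ + h₂
    total = trans (cong (walkWeight μ w̃) (cyclePairs-split (dummy d₁) (dummy d₂) Q R))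
                  (walkWeight-++ μ w̃ (pathPairs (dummy d₁) (Q ∷ʳ dummy d₂))
                                     (pathPairs (dummy d₂) (R ∷ʳ dummy d₁)))

    countVs : dummyCount vs ≡ suc (dummyCount Q ℕ.+ suc (dummyCount R))
    countVs = cong suc (dummyCount-++ Q (dummy d₂ ∷ R))

    fewer₁ : dummyCount (dummy d₁ ∷ Q) ℕ.< dummyCount vs
    fewer₁ = subst (suc (dummyCount Q) ℕ.<_) (sym countVs) (s≤s (ℕ.m<m+n (dummyCount Q) (s≤s z≤n)))

    fewer₂ : dummyCount (dummy d₂ ∷ R) ℕ.< dummyCount vs
    fewer₂ = subst (suc (dummyCount R) ℕ.<_) (sym countVs) (s≤s (ℕ.m≤n+m (suc (dummyCount R)) (dummyCount Q)))

    pick : ClosesOrVanishes d₁ Q d₂ → ClosesOrVanishes d₂ R d₁ →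
           Σ[ C ∈ Cycle ] cycleWeight w̃ C ≤ cyclicWeight μ w̃ vs × dummyCount (verts C) ℕ.< dummyCount vs
    pick (inj₂ h₁≡0) (inj₂ h₂≡0) =
      contradiction negative (<-irrefl (trans total (trans (cong₂ _+_ h₁≡0 h₂≡0) (+-identityˡ 0ℚ))))
    pick (inj₁ (isC₁ , w₁)) (inj₂ h₂≡0) = toDirCycle F μ _ Q isC₁ ,
      ≤-reflexive (trans w₁ (sym (trans total (trans (cong (h₁ +_) h₂≡0) (+-identityʳ h₁))))) , fewer₁
    pick (inj₂ h₁≡0) (inj₁ (isC₂ , w₂)) = toDirCycle F μ _ R isC₂ ,
      ≤-reflexive (trans w₂ (sym (trans total (trans (cong (_+ h₂) h₁≡0) (+-identityˡ h₂))))) , fewer₂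
    pick (inj₁ (isC₁ , w₁)) (inj₁ (isC₂ , w₂)) with realVertex s ∈ᵥ? (dummy d₁ ∷ Q)
    ... | yes s∈ = C₁ , subst₂ _≤_ (sym w₁) (sym total) (0≤y⇒x≤x+y h₁ 0≤h₂) , fewer₁
      where
      C₁ C₂ : Cycle
      C₁ = toDirCycle F μ _ Q isC₁
      C₂ = toDirCycle F μ _ R isC₂

      0≤h₂ : 0ℚ ≤ h₂
      0≤h₂ = subst (0ℚ ≤_) w₂ (nonnegative-avoiding-s C₂ (disjoint s∈))
    ... | no s∉ = C₂ , subst₂ _≤_ (sym w₂) (sym total) (0≤x⇒y≤x+y h₂ 0≤h₁) , fewer₂
      where
      C₁ C₂ : Cycle
      C₁ = toDirCycle F μ _ Q isC₁
      C₂ = toDirCycle F μ _ R isC₂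

      0≤h₁ : 0ℚ ≤ h₁
      0≤h₁ = subst (0ℚ ≤_) w₁ (nonnegative-avoiding-s C₁ s∉)

  splitAtDummy : (vs : List V) → 1 ℕ.≤ dummyCount vs →
                 Σ[ P ∈ List V ] Σ[ d ∈ Fin k ] Σ[ T ∈ List V ]
                   vs ≡ P ++ dummy d ∷ T × dummyCount vs ≡ suc (dummyCount T)
  splitAtDummy (inj₁ a ∷ vs) one with splitAtDummy vs one
  ... | P , d , T , refl , count = inj₁ a ∷ P , d , T , refl , count
  splitAtDummy (inj₂ (inj₁ j) ∷ vs) one with splitAtDummy vs one
  ... | P , d , T , refl , count = inj₂ (inj₁ j) ∷ P , d , T , refl , count
  splitAtDummy (inj₂ (inj₂ d) ∷ vs) _ = [] , d , vs , refl , refl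

  rotateToDummies : (vs : List V) → IsCycle F μ vs → 2 ℕ.≤ dummyCount vs →
    Σ[ d₁ ∈ Fin k ] Σ[ Q ∈ List V ] Σ[ d₂ ∈ Fin k ] Σ[ R ∈ List V ]
      IsCycle F μ (dummy d₁ ∷ Q ++ dummy d₂ ∷ R) ×
      cyclicWeight μ w̃ (dummy d₁ ∷ Q ++ dummy d₂ ∷ R) ≡ cyclicWeight μ w̃ vs ×
      dummyCount (dummy d₁ ∷ Q ++ dummy d₂ ∷ R) ≡ dummyCount vs
  rotateToDummies vs isC two with splitAtDummy vs (ℕ.<⇒≤ two)
  ... | P , d₁ , T , refl , count with splitAtDummy T (ℕ.≤-pred (subst (2 ℕ.≤_) count two))
  ...   | Q , d₂ , R , refl , _ =
    d₁ , Q , d₂ , R ++ P ,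
    subst (IsCycle F μ) reassociate (IsCycle-rotate F μ P _ isC) ,
    trans (cong (cyclicWeight μ w̃) (sym reassociate)) (sym (cyclicWeight-rotate μ w̃ P _)) ,
    trans (cong dummyCount (sym reassociate)) (sym (dummyCount-rotate P _))
    where
    reassociate : (dummy d₁ ∷ Q ++ dummy d₂ ∷ R) ++ P ≡ dummy d₁ ∷ Q ++ dummy d₂ ∷ R ++ P
    reassociate = cong (dummy d₁ ∷_) (++-assoc Q (dummy d₂ ∷ R) P)

  fewerDummies : (C : Cycle) → 2 ℕ.≤ dummyCount (verts C) → cycleWeight w̃ C < 0ℚ →
                 Σ[ C′ ∈ Cycle ] cycleWeight w̃ C′ ≤ cycleWeight w̃ C ×
                                 dummyCount (verts C′) ℕ.< dummyCount (verts C)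
  fewerDummies C two negative with rotateToDummies (verts C) (distinct C , arcs C) two
  ... | d₁ , Q , d₂ , R , isC , sameWeight , sameCount
    with splitAtDummies d₁ d₂ Q R isC (subst (_< 0ℚ) (sym sameWeight) negative)
  ...   | C′ , lighter , fewer = C′ , subst (_ ≤_) sameWeight lighter , subst (_ ℕ.<_) sameCount fewer

  IsMinimum : Cycle → Set
  IsMinimum C = ∀ (D : Cycle) → cycleWeight w̃ C ≤ cycleWeight w̃ D

  minimumWithFewDummies : (N : ℕ) (C : Cycle) → dummyCount (verts C) ℕ.≤ N →
                          IsMinimum C → cycleWeight w̃ C < 0ℚ →
                          Σ[ C′ ∈ Cycle ] IsMinimum C′ × dummyCount (verts C′) ℕ.≤ 1
  minimumWithFewDummies zero    C none  minimum negative = C , minimum , ℕ.≤-trans none z≤n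
  minimumWithFewDummies (suc N) C bound minimum negative with dummyCount (verts C) ℕ.≤? 1
  ... | yes few  = C , minimum , few
  ... | no  many with fewerDummies C (ℕ.≰⇒> many) negative
  ...   | C′ , lighter , fewer = minimumWithFewDummies N C′ (ℕ.≤-pred (ℕ.≤-trans fewer bound))
                                   (λ D → ≤-trans lighter (minimum D)) (≤-<-trans lighter negative)

  negativeCycle⇒minimumWithFewDummies : Σ[ C ∈ Cycle ] cycleWeight w̃ C < 0ℚ →
                                         Σ[ C ∈ Cycle ] IsMinimum C × dummyCount (verts C) ℕ.≤ 1
  negativeCycle⇒minimumWithFewDummies (C₀ , negative) with MinimumCycle.minimumCycle F μ w̃ C₀
  ... | C , minimum =
    minimumWithFewDummies (dummyCount (verts C)) C ℕ.≤-refl minimum (≤-<-trans (minimum C₀) negative)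

-- The hypothesis n < m is not needed: the argument works for any number of dummy vertices.
lemma2 : (m n : ℕ) → n ℕ.< m →
    (E : Fin m → Fin n → Bool) → (w : Fin m → Fin n → ℚ) →
    (μ : Fin m → Fin n ⊎ Fin (m ∸ n) → Bool) →
    IsPerfectMatching (extEdges E) μ →
    (∀ (ν : Fin m → Fin n ⊎ Fin (m ∸ n) → Bool) → IsPerfectMatching (extEdges E) ν →
      matchWeight μ (extWeights w) ≤ matchWeight ν (extWeights w)) →
    (s : Fin m ⊎ Fin n) →
    (w̃ : Fin m → Fin n ⊎ Fin (m ∸ n) → ℚ) →
    (∀ a b → extEdges E a b ≡ true → ¬ Incident s a b → w̃ a b ≡ extWeights w a b) →
    (∀ a d → w̃ a (inj₂ d) ≡ 0ℚ) →
    Σ (DirCycle (extEdges E) μ) (λ C → cycleWeight w̃ C < 0ℚ) →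
    Σ (DirCycle (extEdges E) μ) (λ C →
      (∀ (D : DirCycle (extEdges E) μ) → cycleWeight w̃ C ≤ cycleWeight w̃ D) ×
      dummyCount (verts C) ℕ.≤ 1)
lemma2 m n _ E w μ pm minimal s w̃ w̃≡w w̃-dummy =
  DummyVertices.negativeCycle⇒minimumWithFewDummies E w μ pm minimal s w̃ w̃≡w w̃-dummy
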